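{- Let $p$ be a prime with $p\equiv 3\pmod 4$ and set $n_0=\frac{p^2-1}{2}$. Then, modulo $p$: (i) $u\!\left(\frac{p-1}{2}\right)\equiv 0$; (ii) $u(n)\equiv 0$ for all $n\ge n_0$; (iii) $v(n)\equiv 0$ for all $n>n_0$.
   Context: Define integer sequences $u,v$ by $u(0)=v(0)=1$ and, for $n\ge 1$, $u(n)=\Big(\prod_{j=1}^{n}(4j-1)\Big)^2-\sum_{m=0}^{n-1}\binom{2n+1}{2m+1}\Big(\prod_{j=1}^{n-m}(4j-3)\Big)^2u(m)$, $v(n)=2^{n-1}\Big(\prod_{j=1}^{n}(4j-3)\Big)^2-\frac12\sum_{m=1}^{n-1}\binom{2n}{2m}v(m)v(n-m)$. -}

module Defs where

open import Data.Nat as ℕ using (ℕ; zero; suc)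
open import Data.Nat.Combinatorics using (_C_)
open import Data.Integer as ℤ using (ℤ; +_; _-_; _*_; _+_)
open import Data.Integer.DivMod using (_/_)
open import Data.List using (List; []; _∷_; map; upTo; foldr; _++_; [_])

sumℤ : List ℤ → ℤ
sumℤ = foldr _+_ (+ 0)

prodℤ : List ℤ → ℤ
prodℤ = foldr _*_ (+ 1)

-- product_{j=1}^{n} (4j - a) as an integer (for a ∈ {1,3}, all factors positive)
prod4 : ℕ → ℕ → ℤ
prod4 a n = prodℤ (map (λ i → + (4 ℕ.* suc i ℕ.∸ a)) (upTo n))

sq : ℤ → ℤ
sq x = x * x

-- indexing with a default (used only for indices < length)
at : List ℤ → ℕ → ℤ
at [] _ = + 0
at (x ∷ xs) zero = x
at (x ∷ xs) (suc k) = at xs k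

-- next value of u, given the list [u(0), …, u(n-1)], n ≥ 1
uNext : ℕ → List ℤ → ℤ
uNext n us = sq (prod4 1 n)
  - sumℤ (map (λ m → + ((2 ℕ.* n ℕ.+ 1) C (2 ℕ.* m ℕ.+ 1)) * sq (prod4 3 (n ℕ.∸ m)) * at us m) (upTo n))

uList : ℕ → List ℤ
uList zero = + 1 ∷ []
uList (suc n) = let us = uList n in us ++ [ uNext (suc n) us ]

u : ℕ → ℤ
u n = at (uList n) n

-- next value of v, given [v(0), …, v(n-1)], n ≥ 1.
-- The sum Σ_{m=1}^{n-1} C(2n,2m) v(m) v(n-m) is even (symmetric under m ↦ n-m,
-- middle term C(2n,n) v(n/2)^2 with C(2n,n) even), so `div 2` is exact halving.
vNext : ℕ → List ℤ → ℤ
vNext n vs = + (2 ℕ.^ (n ℕ.∸ 1)) * sq (prod4 3 n)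
  - (sumℤ (map (λ k → + ((2 ℕ.* n) C (2 ℕ.* suc k)) * at vs (suc k) * at vs (n ℕ.∸ suc k)) (upTo (n ℕ.∸ 1)))) / (+ 2)

vList : ℕ → List ℤ
vList zero = + 1 ∷ []
vList (suc n) = let vs = vList n in vs ++ [ vNext (suc n) vs ]

v : ℕ → ℤ
v n = at (vList n) n

{-# OPTIONS --safe #-}
-- Write p = 4t + 3. Then 4j − 1 = p for j = t + 1 and 4j − 3 = 3p for j = 3t + 3, so the squared
-- products in both recurrences vanish mod p for n > t, resp. n > 3t + 2. In the recurrence for
-- u((p − 1)/2) each term of the sum carries a binomial C(p, 2m + 1), divisible by p; this is (i).
-- Since p² = 2n₀ + 1, a binomial C(a + b, a) with a, b < p² ≤ a + b is divisible by p (the base-p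
-- addition of a and b carries). So by strong induction each term of the recurrence for u(n), n ≥ n₀,
-- or v(n), n > n₀, contains an earlier vanishing value, a product ∏(4j − 3) over j > n₀, or such a
-- binomial. For v the halving is exact: the sum is symmetric under m ↦ n − m with even middle
-- coefficient C(2n, n), and p, being odd, still divides the half.
module Submission where

open import Defs
open import Data.Nat using (ℕ; zero; suc; _+_; _*_; _∸_; _/_; _%_; _^_; _≤_; _<_; NonZero; >-nonZero; z≤n; s≤s; z<s; s<s)
open import Data.Nat.Properties
open import Data.Nat.Combinatorics using (_C_; nCk+nC[k+1]≡[n+1]C[k+1]; nCk≡nC[n∸k]; nC1≡n)
open import Data.Nat.Divisibility using (divides; ∣⇒≤; ∣-trans; ∣-refl; m∣m*n; n∣m*n; *-cancelˡ-∣)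
  renaming (_∣_ to _∣ℕ_)
import Data.Nat.Divisibility as ℕ
import Data.Nat.DivMod as ℕ
open import Data.Nat.Primality using (Prime; euclidsLemma; ¬prime[1]; prime⇒nonZero)
open import Data.Nat.Induction using (<-rec)
open import Data.Nat.Tactic.RingSolver using (solve-∀; solve)
open import Data.Integer as ℤ using (ℤ; +_; -[1+_])
import Data.Integer.Properties as ℤ
open import Data.Integer.Divisibility using (_∣_)
open import Data.Integer.Divisibility.Signed
  using (∣m∣n⇒∣m+n; ∣m∣n⇒∣m-n; ∣m⇒∣m*n; ∣n⇒∣m*n; ∣ᵤ⇒∣; ∣⇒∣ᵤ)
  renaming (_∣_ to _∣ℤ_; divides to dividesℤ)
open import Data.Integer.DivMod using (div-pos-is-/ℕ)
import Data.Integer.Tactic.RingSolver as ℤ-Solver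
open import Data.List using (List; []; _∷_; map; upTo; applyUpTo; _++_; [_]; _∷ʳ_; length)
open import Data.List.Properties
  using (foldr-preservesᵇ; foldr-preservesᵒ; applyUpTo-∷ʳ; map-upTo; length-++)
open import Data.List.Relation.Unary.All as All using (All)
import Data.List.Relation.Unary.All.Properties as All
open import Data.List.Relation.Unary.Any using (Any)
import Data.List.Relation.Unary.Any.Properties as Any
open import Data.List.Membership.Propositional using (lose)
open import Data.List.Membership.Propositional.Properties using (∈-upTo⁺)
open import Data.Product using (_×_; _,_)
open import Data.Sum using (inj₁; inj₂; [_,_]′)
open import Function using (_∘_)
open import Relation.Nullary using (¬_; yes; no; contradiction)
open import Relation.Binary.PropositionalEquality
  using (_≡_; refl; sym; trans; cong; cong₂; subst; module ≡-Reasoning)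

C-absorption : ∀ n k → suc k * (suc n C suc k) ≡ suc n * (n C k)
C-absorption zero zero = refl
C-absorption zero (suc k) = *-zeroʳ (suc (suc k))
C-absorption (suc n) zero = trans (*-identityˡ _) (trans (nC1≡n (suc (suc n))) (sym (*-identityʳ _)))
C-absorption (suc n) (suc k) = begin
  suc (suc k) * (suc (suc n) C suc (suc k))
    ≡⟨ cong (suc (suc k) *_) (sym (nCk+nC[k+1]≡[n+1]C[k+1] (suc n) (suc k))) ⟩
  suc (suc k) * (suc n C suc k + suc n C suc (suc k))
    ≡⟨ *-distribˡ-+ (suc (suc k)) (suc n C suc k) (suc n C suc (suc k)) ⟩
  suc n C suc k + suc k * (suc n C suc k) + suc (suc k) * (suc n C suc (suc k))
    ≡⟨ cong₂ (λ x y → suc n C suc k + x + y) (C-absorption n k) (C-absorption n (suc k)) ⟩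
  suc n C suc k + suc n * (n C k) + suc n * (n C suc k)
    ≡⟨ cong (λ x → x + suc n * (n C k) + suc n * (n C suc k)) (sym (nCk+nC[k+1]≡[n+1]C[k+1] n k)) ⟩
  n C k + n C suc k + suc n * (n C k) + suc n * (n C suc k)
    ≡⟨ regroup (n C k) (n C suc k) (suc n) ⟩
  suc (suc n) * (n C k + n C suc k)
    ≡⟨ cong (suc (suc n) *_) (nCk+nC[k+1]≡[n+1]C[k+1] n k) ⟩
  suc (suc n) * (suc n C suc k) ∎
  where
  open ≡-Reasoning
  regroup : ∀ a b m → a + b + m * a + m * b ≡ suc m * (a + b)
  regroup = solve-∀

m∣k*[mCk] : ∀ m k → m ∣ℕ k * (m C k)
m∣k*[mCk] m zero = divides 0 refl
m∣k*[mCk] zero (suc k) = divides 0 (*-zeroʳ (suc k))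
m∣k*[mCk] (suc m) (suc k) = divides (m C k) (trans (C-absorption m k) (*-comm (suc m) (m C k)))

C-sym : ∀ a b → (a + b) C a ≡ (a + b) C b
C-sym a b = trans (nCk≡nC[n∸k] (m≤m+n a b)) (cong ((a + b) C_) (m+n∸m≡n a b))

central-C-even : ∀ a → 2 ∣ℕ (suc a + suc a) C suc a
central-C-even a = divides ((a + suc a) C suc a) (begin
  suc (a + suc a) C suc a
    ≡⟨ sym (nCk+nC[k+1]≡[n+1]C[k+1] (a + suc a) a) ⟩
  (a + suc a) C a + (a + suc a) C suc a
    ≡⟨ cong (_+ (a + suc a) C suc a) (C-sym a (suc a)) ⟩
  (a + suc a) C suc a + (a + suc a) C suc a
    ≡⟨ double ((a + suc a) C suc a) ⟩
  ((a + suc a) C suc a) * 2 ∎)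
  where
  open ≡-Reasoning
  double : ∀ x → x + x ≡ x * 2
  double = solve-∀

-- As k < p^(e+1), k has at most e factors p; cancel them one at a time.
prime^∣k*c⇒∣c : ∀ e {p k c} → Prime p → 0 < k → k < p ^ suc e → p ^ suc e ∣ℕ k * c → p ∣ℕ c
prime^∣k*c⇒∣c e {p} {k} {c} p-prime 0<k k<q q∣kc with euclidsLemma k c p-prime (∣-trans (m∣m*n (p ^ e)) q∣kc)
... | inj₂ p∣c = p∣c
... | inj₁ p∣k with e | p∣k
...   | zero  | _ = contradiction (∣⇒≤ {{>-nonZero 0<k}} p∣k) (<⇒≱ (subst (k <_) (*-identityʳ p) k<q))
...   | suc e | divides zero refl = contradiction 0<k (λ ())
...   | suc e | divides k′@(suc _) refl = prime^∣k*c⇒∣c e p-prime z<s k′<pᵉ pᵉ∣k′c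
  where
  instance _ = prime⇒nonZero p-prime
  k′<pᵉ : k′ < p ^ suc e
  k′<pᵉ = *-cancelˡ-< p k′ (p ^ suc e) (subst (_< p ^ suc (suc e)) (*-comm k′ p) k<q)
  pᵉ∣k′c : p ^ suc e ∣ℕ k′ * c
  pᵉ∣k′c = *-cancelˡ-∣ p (subst (p ^ suc (suc e) ∣ℕ_) (swap k′ p c) q∣kc)
    where
    swap : ∀ x y z → x * y * z ≡ y * (x * z)
    swap = solve-∀

prime^∣C : ∀ e {p k} → Prime p → 0 < k → k < p ^ suc e → p ∣ℕ (p ^ suc e) C k
prime^∣C e {p} {k} p-prime 0<k k<q = prime^∣k*c⇒∣c e p-prime 0<k k<q (m∣k*[mCk] (p ^ suc e) k)

-- When a, b < q ≤ a + b, Pascal's rule reduces C(a + b, a) to the values C(q, k) with 0 < k < q.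
module _ {p q : ℕ} (p∣qCk : ∀ {k} → 0 < k → k < q → p ∣ℕ q C k) where

  ∣C-carry : ∀ d {a b} → a + b ≡ q + d → a < q → b < q → p ∣ℕ (a + b) C a
  ∣C-carry zero {zero} {b} e _ b<q = contradiction (≤-reflexive (sym (trans e (+-identityʳ q)))) (<⇒≱ b<q)
  ∣C-carry zero {suc a} e a<q _ = subst (λ n → p ∣ℕ n C suc a) (sym (trans e (+-identityʳ q))) (p∣qCk z<s a<q)
  ∣C-carry (suc d) {zero} e _ b<q = contradiction (subst (q ≤_) (sym e) (m≤m+n q (suc d))) (<⇒≱ b<q)
  ∣C-carry (suc d) {suc a} {zero} e a<q _ =
    contradiction (subst (q ≤_) (sym (trans (sym (+-identityʳ (suc a))) e)) (m≤m+n q (suc d))) (<⇒≱ a<q)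
  ∣C-carry (suc d) {suc a} {suc b} e a<q b<q =
    subst (p ∣ℕ_) (nCk+nC[k+1]≡[n+1]C[k+1] (a + suc b) a) (ℕ.∣m∣n⇒∣m+n left right)
    where
    e′ : a + suc b ≡ q + d
    e′ = suc-injective (trans e (+-suc q d))
    left : p ∣ℕ (a + suc b) C a
    left = ∣C-carry d e′ (<-trans (n<1+n a) a<q) b<q
    right : p ∣ℕ (a + suc b) C suc a
    right = subst (λ n → p ∣ℕ n C suc a) (sym (+-suc a b))
                  (∣C-carry d (trans (sym (+-suc a b)) e′) a<q (<-trans (n<1+n b) b<q))

∣ℤ-sumℤ : ∀ {d xs} → All (d ∣ℤ_) xs → d ∣ℤ sumℤ xs
∣ℤ-sumℤ = foldr-preservesᵇ ∣m∣n⇒∣m+n (dividesℤ (+ 0) refl)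

∣ℤ-prodℤ : ∀ {d} xs → Any (d ∣ℤ_) xs → d ∣ℤ prodℤ xs
∣ℤ-prodℤ xs = foldr-preservesᵒ (λ x y → [ ∣m⇒∣m*n y , ∣n⇒∣m*n x ]′) (+ 1) xs ∘ inj₂

∣ℕ⇒∣ℤ : ∀ {d n} → d ∣ℕ n → + d ∣ℤ + n
∣ℕ⇒∣ℤ = ∣ᵤ⇒∣

∣sq : ∀ {d x} → d ∣ℤ x → d ∣ℤ sq x
∣sq {x = x} = ∣m⇒∣m*n x

∣prod4 : ∀ a {d n i} → i < n → d ∣ℕ 4 * suc i ∸ a → + d ∣ℤ prod4 a n
∣prod4 a i<n d∣factor = ∣ℤ-prodℤ _ (Any.map⁺ (lose (∈-upTo⁺ i<n) (∣ℕ⇒∣ℤ d∣factor)))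

[i*n]/n≡i : ∀ i n .{{_ : NonZero n}} → (i ℤ.* + n) ℤ./ + n ≡ i
[i*n]/n≡i i n = trans (div-pos-is-/ℕ (i ℤ.* + n) n) (/ℕ-cancel i n)
  where
  /ℕ-cancel : ∀ i n .{{_ : NonZero n}} → (i ℤ.* + n) ℤ./ℕ n ≡ i
  /ℕ-cancel (+ k) n rewrite sym (ℤ.pos-* k n) = cong +_ (ℕ.m*n/n≡m k n)
  /ℕ-cancel -[1+ k ] (suc n)
    rewrite ℕ.m*n%n≡0 (suc k) (suc n) ⦃ _ ⦄ | ℕ.m*n/n≡m (suc k) (suc n) ⦃ _ ⦄ = refl

p∣i⇒p∣i/d : ∀ {p d i} .{{_ : NonZero d}} → Prime p → ¬ p ∣ℕ d → + p ∣ℤ i → + d ∣ℤ i → + p ∣ℤ i ℤ./ + d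
p∣i⇒p∣i/d {p} {d} p-prime p∤d p∣i (dividesℤ q refl) = subst (+ p ∣ℤ_) (sym ([i*n]/n≡i q d)) p∣q
  where
  p∣q : + p ∣ℤ q
  p∣q with euclidsLemma ℤ.∣ q ∣ d p-prime (subst (p ∣ℕ_) (ℤ.abs-* q (+ d)) (∣⇒∣ᵤ p∣i))
  ... | inj₁ p∣∣q∣ = ∣ᵤ⇒∣ p∣∣q∣
  ... | inj₂ p∣d = contradiction p∣d p∤d

sumℤ-∷ʳ : ∀ xs x → sumℤ (xs ∷ʳ x) ≡ sumℤ xs ℤ.+ x
sumℤ-∷ʳ [] x = trans (ℤ.+-identityʳ x) (sym (ℤ.+-identityˡ x))
sumℤ-∷ʳ (y ∷ xs) x = trans (cong (ℤ._+_ y) (sumℤ-∷ʳ xs x)) (sym (ℤ.+-assoc y (sumℤ xs) x))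

palindrome-sumℤ-even : ∀ L (g : ℕ → ℤ) →
  (∀ i j → suc (i + j) ≡ L → g i ≡ g j) →
  (∀ i → suc (i + i) ≡ L → + 2 ∣ℤ g i) →
  + 2 ∣ℤ sumℤ (applyUpTo g L)
palindrome-sumℤ-even zero g _ _ = dividesℤ (+ 0) refl
palindrome-sumℤ-even (suc zero) g _ middle = subst (+ 2 ∣ℤ_) (sym (ℤ.+-identityʳ (g 0))) (middle 0 refl)
palindrome-sumℤ-even (suc (suc L)) g mirror middle
  with palindrome-sumℤ-even L (g ∘ suc)
         (λ i j e → mirror (suc i) (suc j) (cong (suc ∘ suc) (trans (+-suc i j) e)))
         (λ i e → middle (suc i) (cong (suc ∘ suc) (trans (+-suc i i) e)))
... | dividesℤ q inner≡q*2 = dividesℤ (g 0 ℤ.+ q) (begin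
  g 0 ℤ.+ sumℤ (applyUpTo (g ∘ suc) (suc L))
    ≡⟨ cong (λ xs → g 0 ℤ.+ sumℤ xs) (sym (applyUpTo-∷ʳ (g ∘ suc) L)) ⟩
  g 0 ℤ.+ sumℤ (applyUpTo (g ∘ suc) L ∷ʳ g (suc L))
    ≡⟨ cong (ℤ._+_ (g 0)) (sumℤ-∷ʳ (applyUpTo (g ∘ suc) L) (g (suc L))) ⟩
  g 0 ℤ.+ (sumℤ (applyUpTo (g ∘ suc) L) ℤ.+ g (suc L))
    ≡⟨ cong₂ (λ s x → g 0 ℤ.+ (s ℤ.+ x)) inner≡q*2 (sym (mirror 0 (suc L) refl)) ⟩
  g 0 ℤ.+ (q ℤ.* + 2 ℤ.+ g 0)
    ≡⟨ pair (g 0) q ⟩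
  (g 0 ℤ.+ q) ℤ.* + 2 ∎)
  where
  open ≡-Reasoning
  pair : ∀ x s → x ℤ.+ (s ℤ.* + 2 ℤ.+ x) ≡ (x ℤ.+ s) ℤ.* + 2
  pair = ℤ-Solver.solve-∀

at-++ˡ : ∀ xs ys {k} → k < length xs → at (xs ++ ys) k ≡ at xs k
at-++ˡ (x ∷ xs) ys {zero} _ = refl
at-++ˡ (x ∷ xs) ys {suc k} (s<s k<n) = at-++ˡ xs ys k<n

at-++-length : ∀ xs y → at (xs ++ [ y ]) (length xs) ≡ y
at-++-length [] y = refl
at-++-length (x ∷ xs) y = at-++-length xs y

module Appended (xs : ℕ → List ℤ) (next : ℕ → List ℤ → ℤ)
                (length-xs₀ : length (xs 0) ≡ 1)
                (xs-suc : ∀ n → xs (suc n) ≡ xs n ++ [ next (suc n) (xs n) ]) where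

  length-xs : ∀ n → length (xs n) ≡ suc n
  length-xs zero = length-xs₀
  length-xs (suc n) =
    trans (cong length (xs-suc n)) (trans (length-++ (xs n)) (trans (+-comm _ 1) (cong suc (length-xs n))))

  at-xs-last : ∀ n → at (xs (suc n)) (suc n) ≡ next (suc n) (xs n)
  at-xs-last n = trans (cong₂ at (xs-suc n) (sym (length-xs n))) (at-++-length (xs n) _)

  at-xs : ∀ {k n} → k ≤ n → at (xs n) k ≡ at (xs k) k
  at-xs {n = zero} z≤n = refl
  at-xs {k} {suc n} k≤1+n with m≤n⇒m<n∨m≡n k≤1+n
  ... | inj₂ refl = refl
  ... | inj₁ k<1+n@(s≤s k≤n) = begin
    at (xs (suc n)) k                     ≡⟨ cong (λ ys → at ys k) (xs-suc n) ⟩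
    at (xs n ++ [ next (suc n) (xs n) ]) k ≡⟨ at-++ˡ (xs n) _ (subst (k <_) (sym (length-xs n)) k<1+n) ⟩
    at (xs n) k                           ≡⟨ at-xs k≤n ⟩
    at (xs k) k                           ∎
    where open ≡-Reasoning

module U = Appended uList uNext refl (λ _ → refl)
module V = Appended vList vNext refl (λ _ → refl)

u-coefficient : ℕ → ℕ → ℤ
u-coefficient n m = + ((2 * n + 1) C (2 * m + 1)) ℤ.* sq (prod4 3 (n ∸ m))

u-summand : ℕ → List ℤ → ℕ → ℤ
u-summand n us m = u-coefficient n m ℤ.* at us m

v-summand : ℕ → List ℤ → ℕ → ℤ
v-summand n vs k = + ((2 * n) C (2 * suc k)) ℤ.* at vs (suc k) ℤ.* at vs (n ∸ suc k)

2[2+i+j]≡2[1+i]+2[1+j] : ∀ i j → 2 * suc (suc (i + j)) ≡ 2 * suc i + 2 * suc j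
2[2+i+j]≡2[1+i]+2[1+j] = solve-∀

v-summand-mirror : ∀ {L} vs i j → suc (i + j) ≡ L → v-summand (suc L) vs i ≡ v-summand (suc L) vs j
v-summand-mirror vs i j refl = begin
  + Cᵢ ℤ.* x (suc i) ℤ.* x (suc (i + j) ∸ i)
    ≡⟨ cong₂ (λ c k → + c ℤ.* x (suc i) ℤ.* x k) Cᵢ≡Cⱼ (1+i+j∸i≡1+j i j) ⟩
  + Cⱼ ℤ.* x (suc i) ℤ.* x (suc j)
    ≡⟨ swap (+ Cⱼ) (x (suc i)) (x (suc j)) ⟩
  + Cⱼ ℤ.* x (suc j) ℤ.* x (suc i)
    ≡⟨ cong (λ k → + Cⱼ ℤ.* x (suc j) ℤ.* x k) (sym 1+i+j∸j≡1+i) ⟩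
  + Cⱼ ℤ.* x (suc j) ℤ.* x (suc (i + j) ∸ j) ∎
  where
  open ≡-Reasoning
  x = at vs
  Cᵢ = (2 * suc (suc (i + j))) C (2 * suc i)
  Cⱼ = (2 * suc (suc (i + j))) C (2 * suc j)
  Cᵢ≡Cⱼ : Cᵢ ≡ Cⱼ
  Cᵢ≡Cⱼ = subst (λ n → n C (2 * suc i) ≡ n C (2 * suc j)) (sym (2[2+i+j]≡2[1+i]+2[1+j] i j))
                (C-sym (2 * suc i) (2 * suc j))
  1+i+j∸i≡1+j : ∀ i j → suc (i + j) ∸ i ≡ suc j
  1+i+j∸i≡1+j i j = trans (cong (_∸ i) (sym (+-suc i j))) (m+n∸m≡n i (suc j))
  1+i+j∸j≡1+i : suc (i + j) ∸ j ≡ suc i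
  1+i+j∸j≡1+i = trans (cong (λ k → suc k ∸ j) (+-comm i j)) (1+i+j∸i≡1+j j i)
  swap : ∀ a b c → a ℤ.* b ℤ.* c ≡ a ℤ.* c ℤ.* b
  swap = ℤ-Solver.solve-∀

v-summand-middle : ∀ {L} vs i → suc (i + i) ≡ L → + 2 ∣ℤ v-summand (suc L) vs i
v-summand-middle vs i refl =
  ∣m⇒∣m*n (at vs (suc (i + i) ∸ i)) (∣m⇒∣m*n (at vs (suc i)) (∣ℕ⇒∣ℤ 2∣c))
  where
  c = (2 * suc (suc (i + i))) C (2 * suc i)
  2∣c : 2 ∣ℕ c
  2∣c = subst (λ n → 2 ∣ℕ n C (2 * suc i)) (sym (2[2+i+j]≡2[1+i]+2[1+j] i i))
              (central-C-even (i + suc (i + 0)))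

2m+1+2[n∸m]≡2n+1 : ∀ {m n} → m ≤ n → 2 * m + 1 + 2 * (n ∸ m) ≡ 2 * n + 1
2m+1+2[n∸m]≡2n+1 {m} {n} m≤n = trans (regroup m (n ∸ m)) (cong (λ k → 2 * k + 1) (m+[n∸m]≡n m≤n))
  where
  regroup : ∀ m k → 2 * m + 1 + 2 * k ≡ 2 * (m + k) + 1
  regroup = solve-∀

module Vanishing {p n₀ : ℕ} (p-prime : Prime p) (p*p≡1+2n₀ : p * p ≡ suc (2 * n₀))
                 (p∣prod4-3 : ∀ {k} → n₀ < k → + p ∣ℤ prod4 3 k) where

  0<n₀ : 0 < n₀
  0<n₀ = n≢0⇒n>0 λ n₀≡0 →
    ¬prime[1] (subst Prime (m*n≡1⇒n≡1 p p (trans p*p≡1+2n₀ (cong (λ k → suc (2 * k)) n₀≡0))) p-prime)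

  p∣C-carry : ∀ {a b} → a ≤ 2 * n₀ → b ≤ 2 * n₀ → 2 * n₀ < a + b → p ∣ℕ (a + b) C a
  p∣C-carry {a} {b} a≤2n₀ b≤2n₀ 2n₀<a+b =
    ∣C-carry p∣p²Ck (a + b ∸ suc (2 * n₀)) (sym (m+[n∸m]≡n 2n₀<a+b)) (s≤s a≤2n₀) (s≤s b≤2n₀)
    where
    p^2≡1+2n₀ : p ^ 2 ≡ suc (2 * n₀)
    p^2≡1+2n₀ = trans (cong (p *_) (*-identityʳ p)) p*p≡1+2n₀
    p∣p²Ck : ∀ {k} → 0 < k → k < suc (2 * n₀) → p ∣ℕ suc (2 * n₀) C k
    p∣p²Ck {k} 0<k k<q =
      subst (λ q → p ∣ℕ q C k) p^2≡1+2n₀ (prime^∣C 1 p-prime 0<k (subst (k <_) (sym p^2≡1+2n₀) k<q))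

  p∣u-coefficient : ∀ {m n} → m < n₀ → n₀ ≤ n → m ≤ n → + p ∣ℤ u-coefficient n m
  p∣u-coefficient {m} {n} m<n₀ n₀≤n m≤n with n₀ <? n ∸ m
  ... | yes n₀<n∸m = ∣n⇒∣m*n (+ ((2 * n + 1) C (2 * m + 1))) (∣sq (p∣prod4-3 n₀<n∸m))
  ... | no n₀≮n∸m = ∣m⇒∣m*n (sq (prod4 3 (n ∸ m))) (∣ℕ⇒∣ℤ p∣C)
    where
    open ≤-Reasoning
    a≤ : 2 * m + 1 ≤ 2 * n₀
    a≤ = begin
      2 * m + 1   ≡⟨ +-comm (2 * m) 1 ⟩
      suc (2 * m) ≤⟨ n≤1+n _ ⟩
      2 + 2 * m   ≡⟨ *-suc 2 m ⟨
      2 * suc m   ≤⟨ *-monoʳ-≤ 2 m<n₀ ⟩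
      2 * n₀      ∎
    b≤ : 2 * (n ∸ m) ≤ 2 * n₀
    b≤ = *-monoʳ-≤ 2 (≮⇒≥ n₀≮n∸m)
    q≤ : 2 * n₀ < 2 * m + 1 + 2 * (n ∸ m)
    q≤ = begin-strict
      2 * n₀                    <⟨ s≤s (*-monoʳ-≤ 2 n₀≤n) ⟩
      suc (2 * n)               ≡⟨ +-comm 1 (2 * n) ⟩
      2 * n + 1                 ≡⟨ 2m+1+2[n∸m]≡2n+1 m≤n ⟨
      2 * m + 1 + 2 * (n ∸ m)   ∎
    p∣C : p ∣ℕ (2 * n + 1) C (2 * m + 1)
    p∣C = subst (λ N → p ∣ℕ N C (2 * m + 1)) (2m+1+2[n∸m]≡2n+1 m≤n) (p∣C-carry a≤ b≤ q≤)

  p∣v-coefficient : ∀ {i j} → i ≤ n₀ → j ≤ n₀ → n₀ < i + j → p ∣ℕ (2 * (i + j)) C (2 * i)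
  p∣v-coefficient {i} {j} i≤n₀ j≤n₀ n₀<i+j =
    subst (λ N → p ∣ℕ N C (2 * i)) (sym (*-distribˡ-+ 2 i j))
          (p∣C-carry (*-monoʳ-≤ 2 i≤n₀) (*-monoʳ-≤ 2 j≤n₀) q≤)
    where
    open ≤-Reasoning
    q≤ : 2 * n₀ < 2 * i + 2 * j
    q≤ = begin-strict
      2 * n₀        <⟨ *-monoʳ-< 2 (n<1+n n₀) ⟩
      2 * suc n₀    ≤⟨ *-monoʳ-≤ 2 n₀<i+j ⟩
      2 * (i + j)   ≡⟨ *-distribˡ-+ 2 i j ⟩
      2 * i + 2 * j ∎

  u-vanishes : (∀ {n} → n₀ ≤ n → + p ∣ℤ prod4 1 n) → ∀ n → n₀ ≤ n → + p ∣ℤ u n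
  u-vanishes p∣prod4-1 = <-rec _ step
    where
    step : ∀ n → (∀ {m} → m < n → n₀ ≤ m → + p ∣ℤ u m) → n₀ ≤ n → + p ∣ℤ u n
    step zero _ n₀≤0 = contradiction n₀≤0 (<⇒≱ 0<n₀)
    step (suc n) ih n₀≤1+n = subst (+ p ∣ℤ_) (sym (U.at-xs-last n))
      (∣m∣n⇒∣m-n (∣sq (p∣prod4-1 n₀≤1+n)) (∣ℤ-sumℤ (All.map⁺ (All.map p∣summand (All.all-upTo (suc n))))))
      where
      p∣summand : ∀ {m} → m < suc n → + p ∣ℤ u-summand (suc n) (uList n) m
      p∣summand {m} m<1+n with n₀ ≤? m
      ... | yes n₀≤m = ∣n⇒∣m*n (u-coefficient (suc n) m)
                         (subst (+ p ∣ℤ_) (sym (U.at-xs (≤-pred m<1+n))) (ih m<1+n n₀≤m))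
      ... | no n₀≰m = ∣m⇒∣m*n (at (uList n) m) (p∣u-coefficient (≰⇒> n₀≰m) n₀≤1+n (<⇒≤ m<1+n))

  v-vanishes : 2 < p → ∀ n → n₀ < n → + p ∣ℤ v n
  v-vanishes 2<p = <-rec _ step
    where
    step : ∀ n → (∀ {m} → m < n → n₀ < m → + p ∣ℤ v m) → n₀ < n → + p ∣ℤ v n
    step zero _ ()
    step (suc n) ih n₀<1+n = subst (+ p ∣ℤ_) (sym (V.at-xs-last n))
      (∣m∣n⇒∣m-n (∣n⇒∣m*n (+ (2 ^ n)) (∣sq (p∣prod4-3 n₀<1+n))) (p∣i⇒p∣i/d p-prime p∤2 p∣sum 2∣sum))
      where
      g = v-summand (suc n) (vList n)
      x = at (vList n)
      coeff : ℕ → ℕ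
      coeff k = (2 * suc n) C (2 * suc k)
      p∤2 : ¬ p ∣ℕ 2
      p∤2 p∣2 = <⇒≱ 2<p (∣⇒≤ p∣2)
      2∣sum : + 2 ∣ℤ sumℤ (map g (upTo n))
      2∣sum = subst (λ xs → + 2 ∣ℤ sumℤ xs) (sym (map-upTo g n))
                (palindrome-sumℤ-even n g (v-summand-mirror (vList n)) (v-summand-middle (vList n)))
      p∣sum : + p ∣ℤ sumℤ (map g (upTo n))
      p∣sum = ∣ℤ-sumℤ (All.map⁺ (All.map p∣summand (All.all-upTo n)))
        where
        p∣summand : ∀ {k} → k < n → + p ∣ℤ g k
        p∣summand {k} k<n with n₀ <? suc k | n₀ <? n ∸ k
        ... | yes n₀<1+k | _ = ∣m⇒∣m*n (x (n ∸ k)) (∣n⇒∣m*n (+ coeff k)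
                (subst (+ p ∣ℤ_) (sym (V.at-xs k<n)) (ih (s≤s k<n) n₀<1+k)))
        ... | no _ | yes n₀<n∸k = ∣n⇒∣m*n (+ coeff k ℤ.* x (suc k))
                (subst (+ p ∣ℤ_) (sym (V.at-xs (m∸n≤m n k))) (ih (s≤s (m∸n≤m n k)) n₀<n∸k))
        ... | no n₀≮1+k | no n₀≮n∸k = ∣m⇒∣m*n (x (n ∸ k)) (∣m⇒∣m*n (x (suc k)) (∣ℕ⇒∣ℤ p∣coeff))
          where
          1+k+[n∸k]≡1+n : suc k + (n ∸ k) ≡ suc n
          1+k+[n∸k]≡1+n = cong suc (m+[n∸m]≡n (<⇒≤ k<n))
          p∣coeff : p ∣ℕ coeff k
          p∣coeff = subst (λ N → p ∣ℕ (2 * N) C (2 * suc k)) 1+k+[n∸k]≡1+n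
            (p∣v-coefficient (≮⇒≥ n₀≮1+k) (≮⇒≥ n₀≮n∸k) (subst (n₀ <_) (sym 1+k+[n∸k]≡1+n) n₀<1+n))

u-vanishes-at-half : ∀ {p h} → Prime p → p ≡ suc (2 * h) → + p ∣ℤ prod4 1 h → + p ∣ℤ u h
u-vanishes-at-half {h = zero} p-prime refl _ = contradiction p-prime ¬prime[1]
u-vanishes-at-half {p} {suc h} p-prime p≡1+2h p∣prod4-1 = subst (+ p ∣ℤ_) (sym (U.at-xs-last h))
  (∣m∣n⇒∣m-n (∣sq p∣prod4-1) (∣ℤ-sumℤ (All.map⁺ (All.map p∣summand (All.all-upTo (suc h))))))
  where
  p≡2h+1 : p ≡ 2 * suc h + 1
  p≡2h+1 = trans p≡1+2h (+-comm 1 (2 * suc h))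
  p∣pCk : ∀ {k} → 0 < k → k < p → p ∣ℕ p C k
  p∣pCk {k} 0<k k<p =
    subst (λ q → p ∣ℕ q C k) (*-identityʳ p) (prime^∣C 0 p-prime 0<k (subst (k <_) (sym (*-identityʳ p)) k<p))
  p∣summand : ∀ {m} → m < suc h → + p ∣ℤ u-summand (suc h) (uList h) m
  p∣summand {m} m<1+h = ∣m⇒∣m*n (at (uList h) m) (∣m⇒∣m*n (sq (prod4 3 (suc h ∸ m))) (∣ℕ⇒∣ℤ p∣C))
    where
    2m+1<p : 2 * m + 1 < p
    2m+1<p = subst (2 * m + 1 <_) (sym p≡2h+1) (+-monoˡ-< 1 (*-monoʳ-< 2 m<1+h))
    p∣C : p ∣ℕ (2 * suc h + 1) C (2 * m + 1)
    p∣C = subst (λ q → p ∣ℕ q C (2 * m + 1)) p≡2h+1 (p∣pCk (subst (0 <_) (+-comm 1 (2 * m)) z<s) 2m+1<p)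

module ThreeModFour (t : ℕ) where

  private
    ≤-by : ∀ {a b} c → a + c ≡ b → a ≤ b
    ≤-by {a} c a+c≡b = subst (a ≤_) a+c≡b (m≤m+n a c)

  p h n₀ : ℕ
  p = 3 + t * 4
  h = 2 * t + 1
  n₀ = t * t * 8 + t * 12 + 4

  p≡1+2h : p ≡ suc (2 * h)
  p≡1+2h = ring
    where
    ring : 3 + t * 4 ≡ suc (2 * (2 * t + 1))
    ring = solve (t ∷ [])

  p*p≡1+2n₀ : p * p ≡ suc (2 * n₀)
  p*p≡1+2n₀ = ring
    where
    ring : (3 + t * 4) * (3 + t * 4) ≡ suc (2 * (t * t * 8 + t * 12 + 4))
    ring = solve (t ∷ [])

  p∣prod4-1 : ∀ {n} → t < n → + p ∣ℤ prod4 1 n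
  p∣prod4-1 t<n = ∣prod4 1 t<n (subst (λ x → p ∣ℕ x ∸ 1) 1+p≡4[1+t] ∣-refl)
    where
    1+p≡4[1+t] : suc (3 + t * 4) ≡ 4 * suc t
    1+p≡4[1+t] = solve (t ∷ [])

  p∣prod4-3 : ∀ {n} → 2 + t * 3 < n → + p ∣ℤ prod4 3 n
  p∣prod4-3 i<n = ∣prod4 3 i<n (subst (λ x → p ∣ℕ x ∸ 3) 3+3p≡4[3+3t] (n∣m*n 3))
    where
    3+3p≡4[3+3t] : 3 + 3 * (3 + t * 4) ≡ 4 * suc (2 + t * 3)
    3+3p≡4[3+3t] = solve (t ∷ [])

  t<h : t < h
  t<h = ≤-by t ring
    where
    ring : suc t + t ≡ 2 * t + 1
    ring = solve (t ∷ [])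

  t<n₀ : t < n₀
  t<n₀ = ≤-by (t * t * 8 + t * 11 + 3) ring
    where
    ring : suc t + (t * t * 8 + t * 11 + 3) ≡ t * t * 8 + t * 12 + 4
    ring = solve (t ∷ [])

  2+3t<1+n₀ : 2 + t * 3 < suc n₀
  2+3t<1+n₀ = ≤-by (t * t * 8 + t * 9 + 2) ring
    where
    ring : 3 + t * 3 + (t * t * 8 + t * 9 + 2) ≡ suc (t * t * 8 + t * 12 + 4)
    ring = solve (t ∷ [])

p≡3+[p/4]*4 : ∀ p → p % 4 ≡ 3 → p ≡ 3 + p / 4 * 4
p≡3+[p/4]*4 p p%4≡3 = trans (ℕ.m≡m%n+[m/n]*n p 4) (cong (_+ p / 4 * 4) p%4≡3)

[m∸1]/2≡k : ∀ {m k} → m ≡ suc (2 * k) → (m ∸ 1) / 2 ≡ k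
[m∸1]/2≡k {k = k} refl = trans (cong (_/ 2) (*-comm 2 k)) (ℕ.m*n/n≡m k 2)

theorem17 : (p : ℕ) → Prime p → p % 4 ≡ 3 →
    (+ p ∣ u ((p ∸ 1) / 2))
    × (∀ n → (p * p ∸ 1) / 2 ≤ n → + p ∣ u n)
    × (∀ n → (p * p ∸ 1) / 2 < n → + p ∣ v n)
theorem17 p p-prime p%4≡3 with p / 4 | p≡3+[p/4]*4 p p%4≡3
theorem17 .(3 + t * 4) p-prime _ | t | refl =
    ∣⇒∣ᵤ (subst (λ k → + p ∣ℤ u k) (sym [p∸1]/2≡h) (u-vanishes-at-half {h = h} p-prime p≡1+2h (p∣prod4-1 t<h)))
  , (λ n n₀≤n → ∣⇒∣ᵤ (u-vanishes p∣prod4-1-beyond-n₀ n (subst (_≤ n) [p²∸1]/2≡n₀ n₀≤n)))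
  , (λ n n₀<n → ∣⇒∣ᵤ (v-vanishes 2<p n (subst (_< n) [p²∸1]/2≡n₀ n₀<n)))
  where
  open ThreeModFour t
  open Vanishing p-prime p*p≡1+2n₀ (λ n₀<k → p∣prod4-3 (<-≤-trans 2+3t<1+n₀ n₀<k))
  p∣prod4-1-beyond-n₀ : ∀ {n} → n₀ ≤ n → + p ∣ℤ prod4 1 n
  p∣prod4-1-beyond-n₀ n₀≤n = p∣prod4-1 (<-≤-trans t<n₀ n₀≤n)
  [p∸1]/2≡h : (p ∸ 1) / 2 ≡ h
  [p∸1]/2≡h = [m∸1]/2≡k p≡1+2h
  [p²∸1]/2≡n₀ : (p * p ∸ 1) / 2 ≡ n₀
  [p²∸1]/2≡n₀ = [m∸1]/2≡k p*p≡1+2n₀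
  2<p : 2 < p
  2<p = s≤s (s≤s (s≤s z≤n))
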